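{- Let $D$ be a defeasible theory and $S^*_D$ its compiled program for ${ DL}(\partial^*_{||})$. Let $\mathcal P$ be the set of predicates of $S^*_D$, let $\mathcal F$ be the set of predicates of $S^*_D$ of the forms $\mathtt{definitely\_q}$, $\mathtt{body}^\Delta_r$, $\mathtt{lambda\_q}$ and $\mathtt{body}^\lambda_r$, and let $\mathcal Q=\mathcal P\setminus\mathcal F$. Then (a) $\mathcal P$ is downward-closed with floor $\mathcal F$; (b) $\mathcal Q$ has a signing $s$ in which every predicate of the form $\mathtt{defeasibly\_q}$ is assigned $+1$; and (c) for every predicate $q$ of $D$, the predicate $\mathtt{defeasibly\_q}$ avoids negative unfoundedness with respect to $s$.
   Context: Defeasible theories. A literal is an atom $p(t_1,\dots,t_n)$ or its classical negation; ${\sim}q$ is the complementary literal. A defeasible theory $D=(F,R,>)$ consists of a finite set $F$ of variable-free literals (facts), a finite set $R$ of labelled rules $r$ with finite antecedent set $A(r)$, consequent $C(r)$ and kind strict ($\to$), defeasible ($\Rightarrow$) or defeater ($\leadsto$), and an acyclic superiority relation $>$ on labels. Compiled program. For a literal $q$ with predicate $p$, $\mathtt{q}$ denotes $\mathtt{p}$ if $q$ is positive and $\mathtt{not\_p}$ if negative; $\mathtt{{\sim}q}$ is the name of the complement; predicate names are formed by concatenation; rule labels are constants. $S^*_D$ consists exactly of: (i) for each fact $q(\vec a)$: unit clauses $\mathtt{definitely\_q}(\vec a)$, $\mathtt{lambda\_q}(\vec a)$, $\mathtt{defeasibly\_q}(\vec a)$; (ii) for each strict rule $r:q_1(\vec a_1),\dots,q_n(\vec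 a_n)\to q(\vec a)$: $\mathtt{definitely\_q}(\vec a)\,\text{:- }\,\mathtt{body}^\Delta_r(\vec a)$, $\mathtt{lambda\_q}(\vec a)\,\text{:- }\,\mathtt{body}^\Delta_r(\vec a)$, $\mathtt{defeasibly\_q}(\vec a)\,\text{:- }\,\mathtt{body}^\Delta_r(\vec a)$, $\mathtt{body}^\Delta_r(\vec a)\,\text{:- }\,\mathtt{definitely\_q_1}(\vec a_1),\dots,\mathtt{definitely\_q_n}(\vec a_n)$; (iii) for each strict or defeasible rule $r:q_1(\vec a_1),\dots,q_n(\vec a_n)\hookrightarrow q(\vec a)$: $\mathtt{lambda\_q}(\vec a)\,\text{:- }\,not\ \mathtt{definitely\_{\sim}q}(\vec a),\mathtt{body}^\lambda_r(\vec a)$ and $\mathtt{defeasibly\_q}(\vec a)\,\text{:- }\,not\ \mathtt{definitely\_{\sim}q}(\vec a),\mathtt{body}^d_r(\vec a),not\ \mathtt{overruled\_q}(r,\vec a)$; (iv) for each rule $s$ of any kind, $s:q_1(\vec a_1),\dots,q_n(\vec a_n)\hookrightarrow q(\vec a)$: $\mathtt{body}^\lambda_s(\vec a)\,\text{:- }\,\mathtt{lambda\_q_1}(\vec a_1),\dots,\mathtt{lambda\_q_n}(\vec a_n)$ and $\mathtt{body}^d_s(\vec a)\,\text{:- }\,\mathtt{defeasibly\_q_1}(\vec a_1),\dots,\mathtt{defeasibly\_q_n}(\vec a_n)$; (v) for each strict or defeasible rule $r$ with consequent literal $q$ and each rule $s$ with consequent ${\sim}q(\vec b)$: $\mathtt{overruled\_q}(r,\vec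 b)\,\text{:- }\,\mathtt{body}^\lambda_s(\vec b),not\ \mathtt{defeats\_q}(r,s)$; (vi) for each $r>s$ with $r$ having consequent literal $q$, the unit clause $\mathtt{defeats\_q}(r,s)$. Dependencies. For predicates of a program, $p\sqsupseteq_{+1}q$ ($p\sqsupseteq_{ -1}q$) if some clause has head predicate $p$ and a positive (negative) body literal with predicate $q$; $p\sqsupseteq q$ if either holds; $\geq$ is the transitive closure of $\sqsupseteq$ ($p$ depends on $q$ if $p\geq q$), and $q\leq p$ means $p\geq q$. $\geq_{+1},\geq_{ -1}$ are the least relations with $p\geq_{+1}p$ and ($p\sqsupseteq_i q$, $q\geq_j r$ imply $p\geq_{i\cdot j}r$); $q\leq_i p$ means $p\geq_i q$. A set $\mathcal P$ is downward-closed if $p\in\mathcal P$ and $q\leq p$ imply $q\in\mathcal P$; it is downward-closed with floor $\mathcal F$ if $\mathcal F\subset\mathcal P$ and both are downward-closed. A signing for $\mathcal Q$ is a function $s$ from predicates to $\{ -1,+1\}$ such that for $p,q\in\mathcal Q$, $p\leq_i q$ implies $s(p)=s(q)\cdot i$. An infinite sequence of atoms $q_1(\vec a_1),q_2(\vec a_2),\dots$ is unfounded with respect to $\mathcal Q$ if $q_i\sqsupseteq_{+1}q_{i+1}$ and $q_i\in\mathcal Q$ for all $i$. A predicate $p$ avoids negative unfoundedness with respect to a signing $s$ on $\mathcal Q$ if for every predicate $q$ with $s(q)=-1$ on which $p$ depends, no $q$-atom starts a sequence that is unfounded with respect to $\mathcal Q$. -}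

module Defs where

open import Data.Nat using (ℕ; suc)
open import Data.Bool using (Bool; true; false; not)
open import Data.Product using (_×_; _,_; Σ; ∃; proj₁; proj₂)
open import Data.List using (List; []; _∷_; map; concatMap; _++_)
open import Data.List.Membership.Propositional using (_∈_)
open import Data.List.Relation.Unary.All using (All)
open import Data.List.Relation.Unary.Unique.Propositional using (Unique)
open import Data.Sign using (Sign) renaming (_*_ to _*ˢ_)
open import Data.Sum using (_⊎_)
open import Data.Unit using (⊤)
open import Data.Empty using (⊥)
open import Relation.Binary.PropositionalEquality using (_≡_)
open import Relation.Nullary using (¬_; yes; no)
open import Relation.Nullary.Decidable using (⌊_⌋)
import Data.Nat as N
import Data.Bool as B

data Term : Set where
  var : ℕ → Term
  con : ℕ → Term

data IsGround : Term → Set where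
  con-ground : ∀ c → IsGround (con c)

-- Literal names: polarity (true = positive atom p, false = ~p) and predicate symbol.
LName : Set
LName = Bool × ℕ

compl : LName → LName
compl (b , p) = (not b , p)

_≟L_ : LName → LName → Bool
(b , p) ≟L (c , q) = ⌊ b B.≟ c ⌋ B.∧ ⌊ p N.≟ q ⌋

record Literal : Set where
  constructor lit
  field
    pol  : Bool          -- true: p(t⃗), false: ~p(t⃗)
    sym  : ℕ
    args : List Term

lname : Literal → LName
lname l = (Literal.pol l , Literal.sym l)

data Kind : Set where
  strict defeasible defeater : Kind

SD : Kind → Bool
SD strict     = true
SD defeasible = true
SD defeater   = false

Label : Set
Label = ℕ

record Rule : Set where
  field
    label : Label
    kind  : Kind
    ante  : List Literal
    cons  : Literal

open Rule

data Sup⁺ (sup : List (Label × Label)) : Label → Label → Set where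
  [_]  : ∀ {r s} → (r , s) ∈ sup → Sup⁺ sup r s
  _∷ˢ_ : ∀ {r s t} → (r , s) ∈ sup → Sup⁺ sup s t → Sup⁺ sup r t

record Theory : Set where
  field
    facts : List Literal
    rules : List Rule
    sup   : List (Label × Label)     -- (r , s) ∈ sup  means  r > s
    facts-ground  : All (λ l → All IsGround (Literal.args l)) facts
    labels-unique : Unique (map label rules)
    sup-acyclic   : ∀ r → ¬ Sup⁺ sup r r

data Pred : Set where
  definitely lambda defeasibly overruled defeats : LName → Pred
  bodyΔ bodyλ bodyd : Label → Pred

-- Arguments of program atoms: terms of D, or rule labels used as constants.
data PTerm : Set where
  term  : Term → PTerm
  lab   : Label → PTerm

Atom : Set
Atom = Pred × List PTerm

pred : Atom → Pred
pred = proj₁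

-- Body literals: (true , a) is the positive literal a, (false , a) is  not a.
record Clause : Set where
  constructor _:-_
  field
    head : Atom
    body : List (Bool × Atom)

open Clause

targs : List Term → List PTerm
targs = map term

at : (LName → Pred) → Literal → Atom
at P l = (P (lname l) , targs (Literal.args l))

hargs : Rule → List PTerm
hargs r = targs (Literal.args (cons r))

factClauses : Literal → List Clause
factClauses l = (at definitely l :- []) ∷ (at lambda l :- []) ∷ (at defeasibly l :- []) ∷ []

strictClauses : Rule → List Clause
strictClauses r with kind r
... | strict =
      (at definitely (cons r) :- ((true , bΔ) ∷ []))
    ∷ (at lambda (cons r) :- ((true , bΔ) ∷ []))
    ∷ (at defeasibly (cons r) :- ((true , bΔ) ∷ []))
    ∷ (bΔ :- map (λ l → (true , at definitely l)) (ante r))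
    ∷ []
  where bΔ = (bodyΔ (label r) , hargs r)
... | _ = []

sdClauses : Rule → List Clause
sdClauses r with SD (kind r)
... | true =
      (at lambda (cons r) :- ((false , at definitely (lit (not (Literal.pol (cons r))) (Literal.sym (cons r)) (Literal.args (cons r))))
                              ∷ (true , (bodyλ (label r) , hargs r)) ∷ []))
    ∷ (at defeasibly (cons r) :- ((false , at definitely (lit (not (Literal.pol (cons r))) (Literal.sym (cons r)) (Literal.args (cons r))))
                                  ∷ (true , (bodyd (label r) , hargs r))
                                  ∷ (false , (overruled (lname (cons r)) , lab (label r) ∷ hargs r)) ∷ []))
    ∷ []
... | false = []

bodyClauses : Rule → List Clause
bodyClauses s =
    ((bodyλ (label s) , hargs s) :- map (λ l → (true , at lambda l)) (ante s))
  ∷ ((bodyd (label s) , hargs s) :- map (λ l → (true , at defeasibly l)) (ante s))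
  ∷ []

overClauses : List Rule → Rule → List Clause
overClauses rs r with SD (kind r)
... | false = []
... | true = concatMap go rs
  where
  go : Rule → List Clause
  go s with lname (cons s) ≟L compl (lname (cons r))
  ... | true  = ((overruled (lname (cons r)) , lab (label r) ∷ hargs s)
                 :- ((true , (bodyλ (label s) , hargs s))
                    ∷ (false , (defeats (lname (cons r)) , lab (label r) ∷ lab (label s) ∷ [])) ∷ []))
                ∷ []
  ... | false = []

supClauses : List Rule → Label × Label → List Clause
supClauses rs (r , s) = concatMap go rs
  where
  go : Rule → List Clause
  go ρ with ⌊ label ρ N.≟ r ⌋
  ... | true  = ((defeats (lname (cons ρ)) , lab r ∷ lab s ∷ []) :- []) ∷ []
  ... | false = []

compile : Theory → List Clause
compile D =
     concatMap factClauses (Theory.facts D)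
  ++ concatMap strictClauses (Theory.rules D)
  ++ concatMap sdClauses (Theory.rules D)
  ++ concatMap bodyClauses (Theory.rules D)
  ++ concatMap (overClauses (Theory.rules D)) (Theory.rules D)
  ++ concatMap (supClauses (Theory.rules D)) (Theory.sup D)

Program : Set
Program = List Clause

-- p ⊒_i q : some clause has head predicate p and a body literal of polarity i with predicate q
-- (polarity encoded as a Bool: true = positive, false = negative)
_⊢_⊒[_]_ : Program → Pred → Bool → Pred → Set
S ⊢ p ⊒[ b ] q = Σ Clause λ c → c ∈ S × pred (head c) ≡ p × Σ Atom λ a → (b , a) ∈ body c × pred a ≡ q

toSign : Bool → Sign
toSign true  = Sign.+
toSign false = Sign.-

_⊢_⊒_ : Program → Pred → Pred → Set
S ⊢ p ⊒ q = Σ Bool λ b → S ⊢ p ⊒[ b ] q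

data _⊢_≥_ (S : Program) : Pred → Pred → Set where
  one  : ∀ {p q} → S ⊢ p ⊒ q → S ⊢ p ≥ q
  step : ∀ {p q r} → S ⊢ p ⊒ q → S ⊢ q ≥ r → S ⊢ p ≥ r

data _⊢_≥[_]_ (S : Program) : Pred → Sign → Pred → Set where
  refl≥ : ∀ {p} → S ⊢ p ≥[ Sign.+ ] p
  step≥ : ∀ {p q r b j} → S ⊢ p ⊒[ b ] q → S ⊢ q ≥[ j ] r → S ⊢ p ≥[ toSign b *ˢ j ] r

PredOf : Program → Pred → Set
PredOf S p = Σ Clause λ c → c ∈ S × (pred (head c) ≡ p ⊎ Σ (Bool × Atom) λ l → l ∈ body c × pred (proj₂ l) ≡ p)

DownwardClosed : Program → (Pred → Set) → Set
DownwardClosed S X = ∀ p q → X p → S ⊢ p ≥ q → X q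

-- downward-closed with floor F  (F ⊆ P, reading ⊂ as ⊆)
DownwardClosedWithFloor : Program → (Pred → Set) → (Pred → Set) → Set
DownwardClosedWithFloor S P F = (∀ p → F p → P p) × DownwardClosed S P × DownwardClosed S F

Signing : Program → (Pred → Set) → (Pred → Sign) → Set
Signing S Q s = ∀ p q i → Q p → Q q → S ⊢ q ≥[ i ] p → s p ≡ s q *ˢ i

Unfounded : Program → (Pred → Set) → (ℕ → Atom) → Set
Unfounded S Q f = ∀ n → S ⊢ pred (f n) ⊒[ true ] pred (f (suc n)) × Q (pred (f n))

AvoidsNegUnfounded : Program → (Pred → Set) → (Pred → Sign) → Pred → Set
AvoidsNegUnfounded S Q s p =
  ∀ q → s q ≡ Sign.- → S ⊢ p ≥ q → ∀ (f : ℕ → Atom) → pred (f 0) ≡ q → ¬ Unfounded S Q f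

IsFloorForm : Pred → Set
IsFloorForm (definitely _) = ⊤
IsFloorForm (lambda _) = ⊤
IsFloorForm (bodyΔ _) = ⊤
IsFloorForm (bodyλ _) = ⊤
IsFloorForm _ = ⊥

𝒫 : Theory → Pred → Set
𝒫 D = PredOf (compile D)

𝓕 : Theory → Pred → Set
𝓕 D p = 𝒫 D p × IsFloorForm p

𝒬 : Theory → Pred → Set
𝒬 D p = 𝒫 D p × ¬ IsFloorForm p

{-# OPTIONS --safe #-}
-- Sign every predicate +1 except overruled_q, which gets −1.  Then every edge
-- h ⊒_b p of S*_D satisfies: a floor head has a floor body predicate; if p is
-- outside the floor, s(p) = s(h)·b; and a positive edge out of overruled_q goes
-- to body^λ_s, in the floor.  The first property gives (a).  Along a path ending
-- outside the floor no predicate lies in the floor, so the second multiplies up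
-- to (b).  By the third, an unfounded sequence cannot start at overruled_q: its
-- second atom would be a floor atom, not in Q, which gives (c).
module Submission where

open import Defs
open import Data.Bool using (Bool; true; false)
open import Data.Empty using (⊥-elim)
open import Data.Nat using (_≟_)
open import Data.List using (List; concatMap)
open import Data.List.Membership.Propositional using (_∈_)
open import Data.List.Membership.Propositional.Properties using (∈-concatMap⁻)
open import Data.List.Relation.Unary.All as All using (All; []; _∷_)
open import Data.List.Relation.Unary.All.Properties using (++⁺; concat⁺; map⁺)
open import Data.List.Relation.Unary.Any using (here; satisfied)
open import Data.Product using (_×_; Σ; _,_; proj₁; proj₂)
open import Data.Sign using (Sign) renaming (_*_ to _*ˢ_)
open import Data.Sign.Properties using (*-assoc; *-identityʳ)
open import Data.Sum using (inj₂)
open import Data.Unit using (tt)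
open import Relation.Binary.PropositionalEquality using (_≡_; refl; sym; cong; module ≡-Reasoning)
open import Relation.Nullary using (¬_; yes; no)
open import Relation.Nullary.Decidable using (⌊_⌋)
open import Relation.Unary using (Decidable)
open Clause
open Rule

sign : Pred → Sign
sign (overruled _) = Sign.-
sign _             = Sign.+

isFloorForm? : Decidable IsFloorForm
isFloorForm? (definitely _) = yes tt
isFloorForm? (lambda _)     = yes tt
isFloorForm? (bodyΔ _)      = yes tt
isFloorForm? (bodyλ _)      = yes tt
isFloorForm? (defeasibly _) = no λ ()
isFloorForm? (overruled _)  = no λ ()
isFloorForm? (defeats _)    = no λ ()
isFloorForm? (bodyd _)      = no λ ()

record SignedEdge (h : Pred) (b : Bool) (p : Pred) : Set where
  constructor signedEdge
  field
    floor-closed  : IsFloorForm h → IsFloorForm p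
    sign-multiply : ¬ IsFloorForm p → sign p ≡ sign h *ˢ toSign b
    negative-positive⇒floor : sign h ≡ Sign.- → b ≡ true → IsFloorForm p

open SignedEdge

SignedClause : Clause → Set
SignedClause c = All (λ (b , a) → SignedEdge (pred (head c)) b (pred a)) (body c)

edge-to-floor : ∀ {h b p} → IsFloorForm p → SignedEdge h b p
edge-to-floor fp = signedEdge (λ _ → fp) (λ ¬fp → ⊥-elim (¬fp fp)) (λ _ _ → fp)

module _ {S : Program} (signed : ∀ {h b p} → S ⊢ h ⊒[ b ] p → SignedEdge h b p) where

  floor-≥-closed : ∀ {p q} → IsFloorForm p → S ⊢ p ≥ q → IsFloorForm q
  floor-≥-closed fp (one (_ , e))    = floor-closed (signed e) fp
  floor-≥-closed fp (step (_ , e) r) = floor-≥-closed (floor-closed (signed e) fp) r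

  floor-≥[]-closed : ∀ {p i q} → IsFloorForm p → S ⊢ p ≥[ i ] q → IsFloorForm q
  floor-≥[]-closed fp refl≥      = fp
  floor-≥[]-closed fp (step≥ e r) = floor-≥[]-closed (floor-closed (signed e) fp) r

  sign-≥[] : ∀ {q i p} → ¬ IsFloorForm p → S ⊢ q ≥[ i ] p → sign p ≡ sign q *ˢ i
  sign-≥[] {q} _ refl≥ = sym (*-identityʳ (sign q))
  sign-≥[] {q} {p = p} ¬fp (step≥ {q = q′} {b = b} {j = j} e r) with isFloorForm? q′
  ... | yes fq′ = ⊥-elim (¬fp (floor-≥[]-closed fq′ r))
  ... | no ¬fq′ = begin
    sign p                     ≡⟨ sign-≥[] ¬fp r ⟩
    sign q′ *ˢ j               ≡⟨ cong (_*ˢ j) (sign-multiply (signed e) ¬fq′) ⟩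
    sign q *ˢ toSign b *ˢ j    ≡⟨ *-assoc (sign q) (toSign b) j ⟩
    sign q *ˢ (toSign b *ˢ j)  ∎
    where open ≡-Reasoning

  module _ {Q : Pred → Set} (Q⇒¬floor : ∀ {p} → Q p → ¬ IsFloorForm p) where

    sign-signing : Signing S Q sign
    sign-signing _ _ _ Qp _ = sign-≥[] (Q⇒¬floor Qp)

    sign-avoidsNegUnfounded : ∀ p → AvoidsNegUnfounded S Q sign p
    sign-avoidsNegUnfounded _ _ sq _ _ refl unfounded =
      Q⇒¬floor (proj₂ (unfounded 1))
        (negative-positive⇒floor (signed (proj₁ (unfounded 0))) sq refl)

≥⇒PredOf : ∀ {S p q} → S ⊢ p ≥ q → PredOf S q
≥⇒PredOf (one (b , c , c∈ , _ , a , l∈ , a≡q)) = c , c∈ , inj₂ ((b , a) , l∈ , a≡q)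
≥⇒PredOf (step _ r) = ≥⇒PredOf r

All-signed⇒⊒-signed : ∀ {S} → All SignedClause S → ∀ {h b p} → S ⊢ h ⊒[ b ] p → SignedEdge h b p
All-signed⇒⊒-signed signedS (c , c∈ , refl , a , l∈ , refl) = All.lookup (All.lookup signedS c∈) l∈

All-concatMap⁺ : ∀ {A B : Set} {P : B → Set} {f : A → List B} →
                 (∀ x → All P (f x)) → ∀ xs → All P (concatMap f xs)
All-concatMap⁺ Pf xs = concat⁺ (map⁺ (All.universal Pf xs))

factClauses-signed : ∀ l → All SignedClause (factClauses l)
factClauses-signed l = [] ∷ [] ∷ [] ∷ []

strictClauses-signed : ∀ r → All SignedClause (strictClauses r)
strictClauses-signed r with kind r
... | strict     = (edge-to-floor tt ∷ []) ∷ (edge-to-floor tt ∷ []) ∷ (edge-to-floor tt ∷ [])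
                 ∷ map⁺ (All.universal (λ _ → edge-to-floor tt) (ante r)) ∷ []
... | defeasible = []
... | defeater   = []

sdClauses-signed : ∀ r → All SignedClause (sdClauses r)
sdClauses-signed r with SD (kind r)
... | true  = (edge-to-floor tt ∷ edge-to-floor tt ∷ [])
            ∷ (edge-to-floor tt ∷ signedEdge (λ ()) (λ _ → refl) (λ ())
                                ∷ signedEdge (λ ()) (λ _ → refl) (λ ()) ∷ [])
            ∷ []
... | false = []

bodyClauses-signed : ∀ s → All SignedClause (bodyClauses s)
bodyClauses-signed s =
    map⁺ (All.universal (λ _ → edge-to-floor tt) (ante s))
  ∷ map⁺ (All.universal (λ _ → signedEdge (λ ()) (λ _ → refl) (λ ())) (ante s))
  ∷ []

overClauses-signed : ∀ rs r {c} → c ∈ overClauses rs r → SignedClause c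
overClauses-signed rs r c∈ with SD (kind r)
... | true with satisfied (∈-concatMap⁻ _ {xs = rs} c∈)
... | s , _ with lname (cons s) ≟L compl (lname (cons r))
overClauses-signed rs r c∈ | true | s , here refl | true =
  edge-to-floor tt ∷ signedEdge (λ ()) (λ _ → refl) (λ _ ()) ∷ []

supClauses-signed : ∀ rs r>s {c} → c ∈ supClauses rs r>s → SignedClause c
supClauses-signed rs (r , s) c∈ with satisfied (∈-concatMap⁻ _ {xs = rs} c∈)
... | ρ , _ with ⌊ label ρ ≟ r ⌋
supClauses-signed rs (r , s) c∈ | ρ , here refl | true = []

compile-signed : ∀ D → All SignedClause (compile D)
compile-signed D =
  ++⁺ (All-concatMap⁺ factClauses-signed facts)
  (++⁺ (All-concatMap⁺ strictClauses-signed rules)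
  (++⁺ (All-concatMap⁺ sdClauses-signed rules)
  (++⁺ (All-concatMap⁺ bodyClauses-signed rules)
  (++⁺ (All-concatMap⁺ (λ r → All.tabulate (overClauses-signed rules r)) rules)
       (All-concatMap⁺ (λ r>s → All.tabulate (supClauses-signed rules r>s)) sup)))))
  where open Theory D

corollary2 : (D : Theory) →
    DownwardClosedWithFloor (compile D) (𝒫 D) (𝓕 D)
    × Σ (Pred → Sign) (λ s →
        Signing (compile D) (𝒬 D) s
        × (∀ q → s (defeasibly q) ≡ Sign.+)
        × (∀ q → AvoidsNegUnfounded (compile D) (𝒬 D) s (defeasibly q)))
corollary2 D =
    ( (λ _ → proj₁)
    , (λ _ _ _ → ≥⇒PredOf)
    , (λ _ _ (_ , fp) p≥q → ≥⇒PredOf p≥q , floor-≥-closed signed fp p≥q) )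
  , sign
  , sign-signing signed {𝒬 D} proj₂
  , (λ _ → refl)
  , (λ q → sign-avoidsNegUnfounded signed {𝒬 D} proj₂ (defeasibly q))
  where
  signed : ∀ {h b p} → compile D ⊢ h ⊒[ b ] p → SignedEdge h b p
  signed = All-signed⇒⊒-signed (compile-signed D)
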